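{- Let $k\in\{2,3\}$ and $\mathbf{x}\in\Sigma_q^*$, and suppose $T_{i,k}(\mathbf{x})=\mathbf{u}\mathbf{v}\mathbf{v}\mathbf{w}$ where $\mathbf{x}=\mathbf{u}\mathbf{v}\mathbf{w}$, $|\mathbf{u}|=i$, $|\mathbf{v}|=k$. If the symbols of $\mathbf{v}$ are not pairwise distinct, then there exist integers $k>\ell_1\ge\ell_2\ge 1$ and nonnegative integers $j_1,j_2$ such that $T_{j_2,\ell_2}\circ T_{j_1,\ell_1}(\mathbf{x})=T_{i,k}(\mathbf{x})$.
   Context: $\Sigma_q=\{0,\dots,q-1\}$ with $q\ge2$; $\Sigma_q^*$ is the set of finite words over $\Sigma_q$. For integers $k\ge1$, $i\ge0$ with $i+k\le|\mathbf{x}|$, the tandem duplication $T_{i,k}$ maps $\mathbf{x}=\mathbf{u}\mathbf{v}\mathbf{w}$ with $|\mathbf{u}|=i$, $|\mathbf{v}|=k$ to $\mathbf{u}\mathbf{v}\mathbf{v}\mathbf{w}$. -}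

module Defs where

open import Data.List using (List; take; drop; _++_; length)
open import Data.Nat using (ℕ; _+_; _≤_)

-- Tandem duplication T_{i,k}: for x = u v w with |u| = i, |v| = k,
-- returns u v v w.  Only meaningful when i + k ≤ length x
-- (the statement always carries that side condition).
T : {A : Set} → ℕ → ℕ → List A → List A
T i k x = take i x ++ take k (drop i x) ++ drop i x

factor : {A : Set} → ℕ → ℕ → List A → List A
factor i k x = take k (drop i x)

module Submission where

-- The argument is
-- local: T only changes the word at position i, so a decomposition found
-- for the suffix starting at position i lifts to the whole word by
-- prepending the prefix one letter at a time (`ViaShorter-∷`).  At the front
-- of the word (i = 0) we inspect the k ∈ {2,3} letters of v:
--   v = aa   :  T_{0,2} = T_{0,1} ∘ T_{0,1}
--   v = aac  :  T_{0,3} = T_{3,1} ∘ T_{1,2}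
--   v = aba  :  T_{0,3} = T_{2,1} ∘ T_{0,2}
--   v = abb  :  T_{0,3} = T_{1,1} ∘ T_{0,2}
-- and every non-injective v of length 2 or 3 has one of these shapes
-- (`repeat₂`, `repeat₃`, using decidable equality of the alphabet).
-- Everything is proved for an arbitrary alphabet with decidable equality;
-- the theorem `lemma6` is the instance A = Fin q.

open import Defs
open import Data.Fin using (Fin)
open import Data.Fin.Properties using (_≟_)
open import Data.List using (List; length; []; _∷_; take)
open import Data.List.Relation.Unary.Unique.Propositional using (Unique)
open import Data.List.Relation.Unary.AllPairs using ([]; _∷_)
open import Data.List.Relation.Unary.All using ([]; _∷_)
open import Data.Nat using (ℕ; _+_; _≤_; _<_; zero; suc; s≤s; z≤n)
open import Data.Nat.Properties using (≤-refl)
open import Data.Product using (Σ; _×_; _,_)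
open import Data.Sum using (_⊎_; inj₁; inj₂)
open import Function using (_∘_)
open import Relation.Binary.Definitions using (DecidableEquality)
open import Relation.Binary.PropositionalEquality using (_≡_; refl; cong)
open import Relation.Nullary using (¬_)
open import Relation.Nullary.Decidable using (decidable-stable; _⊎-dec_)

ViaShorter : {A : Set} → ℕ → List A → List A → Set
ViaShorter k x y = Σ ℕ λ ℓ₁ → Σ ℕ λ ℓ₂ → Σ ℕ λ j₁ → Σ ℕ λ j₂ →
  ℓ₁ < k × ℓ₂ ≤ ℓ₁ × 1 ≤ ℓ₂ ×
  j₁ + ℓ₁ ≤ length x × j₂ + ℓ₂ ≤ length (T j₁ ℓ₁ x) ×
  T j₂ ℓ₂ (T j₁ ℓ₁ x) ≡ y

-- Locality: since T (suc j) ℓ (a ∷ x) = a ∷ T j ℓ x, a decomposition of a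
-- duplication on x shifts by one position to a decomposition on a ∷ x.
ViaShorter-∷ : {A : Set} {k : ℕ} {x y : List A} (a : A) →
  ViaShorter k x y → ViaShorter k (a ∷ x) (a ∷ y)
ViaShorter-∷ a (ℓ₁ , ℓ₂ , j₁ , j₂ , ℓ₁<k , ℓ₂≤ℓ₁ , 1≤ℓ₂ , in-x , in-Tx , eq) =
  ℓ₁ , ℓ₂ , suc j₁ , suc j₂ , ℓ₁<k , ℓ₂≤ℓ₁ , 1≤ℓ₂ , s≤s in-x , s≤s in-Tx , cong (a ∷_) eq

module _ {A : Set} where

  -- v = aa:  T_{0,2}(aaw) = aaaaw = T_{0,1}(T_{0,1}(aaw))
  front-aa : (a : A) (w : List A) → ViaShorter 2 (a ∷ a ∷ w) (T 0 2 (a ∷ a ∷ w))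
  front-aa a w = 1 , 1 , 0 , 0 , ≤-refl , ≤-refl , ≤-refl , s≤s z≤n , s≤s z≤n , refl

  -- v = aac: T_{0,3}(aacw) = aacaacw = T_{3,1}(T_{1,2}(aacw)) = T_{3,1}(aacacw)
  front-aac : (a c : A) (w : List A) → ViaShorter 3 (a ∷ a ∷ c ∷ w) (T 0 3 (a ∷ a ∷ c ∷ w))
  front-aac a c w = 2 , 1 , 1 , 3 , ≤-refl , s≤s z≤n , ≤-refl ,
    s≤s (s≤s (s≤s z≤n)) , s≤s (s≤s (s≤s (s≤s z≤n))) , refl

  -- v = aba: T_{0,3}(abaw) = abaabaw = T_{2,1}(T_{0,2}(abaw)) = T_{2,1}(ababaw)
  front-aba : (a b : A) (w : List A) → ViaShorter 3 (a ∷ b ∷ a ∷ w) (T 0 3 (a ∷ b ∷ a ∷ w))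
  front-aba a b w = 2 , 1 , 0 , 2 , ≤-refl , s≤s z≤n , ≤-refl ,
    s≤s (s≤s z≤n) , s≤s (s≤s (s≤s z≤n)) , refl

  -- v = abb: T_{0,3}(abbw) = abbabbw = T_{1,1}(T_{0,2}(abbw)) = T_{1,1}(ababbw)
  front-abb : (a b : A) (w : List A) → ViaShorter 3 (a ∷ b ∷ b ∷ w) (T 0 3 (a ∷ b ∷ b ∷ w))
  front-abb a b w = 2 , 1 , 0 , 1 , ≤-refl , s≤s z≤n , ≤-refl ,
    s≤s (s≤s z≤n) , s≤s (s≤s z≤n) , refl

  module _ (_≟ᴬ_ : DecidableEquality A) where

    repeat₂ : {a b : A} → ¬ Unique (a ∷ b ∷ []) → a ≡ b
    repeat₂ {a} {b} non-unique =
      decidable-stable (a ≟ᴬ b) (λ a≢b → non-unique ((a≢b ∷ []) ∷ [] ∷ []))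

    repeat₃ : {a b c : A} → ¬ Unique (a ∷ b ∷ c ∷ []) → a ≡ b ⊎ a ≡ c ⊎ b ≡ c
    repeat₃ {a} {b} {c} non-unique =
      decidable-stable (a ≟ᴬ b ⊎-dec a ≟ᴬ c ⊎-dec b ≟ᴬ c) λ distinct →
        non-unique ( (distinct ∘ inj₁ ∷ distinct ∘ inj₂ ∘ inj₁ ∷ [])
                   ∷ (distinct ∘ inj₂ ∘ inj₂ ∷ [])
                   ∷ [] ∷ [])

    front : (k : ℕ) → (k ≡ 2 ⊎ k ≡ 3) → (x : List A) → k ≤ length x →
      ¬ Unique (take k x) → ViaShorter k x (T 0 k x)
    front _ (inj₁ refl) (a ∷ b ∷ w) _ non-unique with repeat₂ non-unique
    ... | refl = front-aa a w
    front _ (inj₂ refl) (a ∷ b ∷ c ∷ w) _ non-unique with repeat₃ non-unique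
    ... | inj₁ refl        = front-aac a c w
    ... | inj₂ (inj₁ refl) = front-aba a b w
    ... | inj₂ (inj₂ refl) = front-abb a b w
    front _ (inj₁ refl) (_ ∷ []) (s≤s ())
    front _ (inj₂ refl) (_ ∷ []) (s≤s ())
    front _ (inj₂ refl) (_ ∷ _ ∷ []) (s≤s (s≤s ()))

    repeat-duplication : (k : ℕ) → (k ≡ 2 ⊎ k ≡ 3) → (x : List A) (i : ℕ) →
      i + k ≤ length x → ¬ Unique (factor i k x) → ViaShorter k x (T i k x)
    repeat-duplication k k∈23 x zero in-x non-unique = front k k∈23 x in-x non-unique
    repeat-duplication k k∈23 (a ∷ x) (suc i) (s≤s in-x) non-unique =
      ViaShorter-∷ a (repeat-duplication k k∈23 x i in-x non-unique)

lemma6 : (q : ℕ) → 2 ≤ q → (k : ℕ) → (k ≡ 2 ⊎ k ≡ 3) →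
    (x : List (Fin q)) → (i : ℕ) → i + k ≤ length x →
    ¬ Unique (factor i k x) →
    Σ ℕ λ ℓ₁ → Σ ℕ λ ℓ₂ → Σ ℕ λ j₁ → Σ ℕ λ j₂ →
    ℓ₁ < k × ℓ₂ ≤ ℓ₁ × 1 ≤ ℓ₂ ×
    j₁ + ℓ₁ ≤ length x × j₂ + ℓ₂ ≤ length (T j₁ ℓ₁ x) ×
    T j₂ ℓ₂ (T j₁ ℓ₁ x) ≡ T i k x
lemma6 _ _ = repeat-duplication _≟_
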